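{- Let $G$ be a finite group of odd order. Then the power graph $P(G\times C_2)$ has a perfect matching.
   Context: The power graph $P(H)$ of a finite group $H$ is the simple undirected graph with vertex set $H$ in which distinct $x,y$ are adjacent iff one is a power of the other. $C_2$ is the cyclic group of order $2$. A perfect matching is a set of pairwise vertex-disjoint edges covering every vertex. -}

module Defs where

open import Level using (0ℓ)
open import Data.Nat using (ℕ; zero; suc)
open import Data.Nat.Divisibility using (_∣_)
open import Data.Fin using (Fin)
open import Data.Product using (Σ; ∃; _×_)
open import Data.Sum using (_⊎_)
open import Relation.Nullary using (¬_)
open import Relation.Binary.PropositionalEquality as ≡ using (_≡_)
open import Function.Bundles using (Inverse)
open import Algebra.Bundles using (Group; AbelianGroup; CommutativeRing)
open import Data.Bool.Properties using (xor-∧-commutativeRing)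
import Algebra.Construct.DirectProduct as DP

pow : ∀ {c ℓ} (G : Group c ℓ) → Group.Carrier G → ℕ → Group.Carrier G
pow G x zero    = Group.ε G
pow G x (suc k) = Group._∙_ G x (pow G x k)

HasOrder : ∀ {c ℓ} (G : Group c ℓ) → ℕ → Set _
HasOrder G n = Inverse (Group.setoid G) (≡.setoid (Fin n))

PowerAdj : ∀ {c ℓ} (G : Group c ℓ) → Group.Carrier G → Group.Carrier G → Set _
PowerAdj G x y =
  ¬ (Group._≈_ G x y) ×
  ((∃ λ (k : ℕ) → Group._≈_ G x (pow G y k)) ⊎ (∃ λ (k : ℕ) → Group._≈_ G y (pow G x k)))

record PerfectMatching {c ℓ} (G : Group c ℓ) : Set (Level.suc (c Level.⊔ ℓ)) where
  open Group G
  field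
    M        : Carrier → Carrier → Set (c Level.⊔ ℓ)
    M-resp   : ∀ {x x′ y y′} → x ≈ x′ → y ≈ y′ → M x y → M x′ y′
    M-sym    : ∀ {x y} → M x y → M y x
    M-edge   : ∀ {x y} → M x y → PowerAdj G x y
    M-cover  : ∀ x → ∃ λ y → M x y
    M-unique : ∀ {x y z} → M x y → M x z → y ≈ z

-- The cyclic group C₂, realised as (Bool, xor, false)
C₂ : Group 0ℓ 0ℓ
C₂ = AbelianGroup.group (CommutativeRing.+-abelianGroup xor-∧-commutativeRing)

_×C₂ : Group 0ℓ 0ℓ → Group 0ℓ 0ℓ
G ×C₂ = DP.group G C₂

-- In a group of odd order no element squares to the identity: right multiplication by such an
-- element would be a fixed-point-free involution of the group, which pairs up its elements.
-- Hence every x has odd order 2m+1 (halve an even exponent killing x), so x = x^(2m+2) is an even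
-- power of itself. In G × C₂ this gives (x, 0) = (x, 1)^(2m+2), so pairing (x, 0) with (x, 1) for
-- every x is a perfect matching of the power graph.
{-# OPTIONS --safe #-}
module Submission where

open import Defs
open import Level using (0ℓ)
open import Data.Nat using (ℕ; zero; suc; _+_; _∸_; _<_)
open import Data.Nat.Properties as ℕ using (+-suc; n<1+n; m+[n∸m]≡n; m≤m+n; ≤-<-trans)
open import Data.Nat.Divisibility using (_∣_; divides)
open import Data.Nat.Induction using (<-rec)
open import Data.Fin as Fin using (Fin; zero; suc; punchIn; punchOut; toℕ)
open import Data.Fin.Properties
  using (0≢1+n; punchInᵢ≢i; punchIn-punchOut; punchOut-cong; punchOut-punchIn; pigeonhole; suc-injective)
open import Data.Bool using (true; false; not)
open import Data.Bool.Properties using (xor-same; not-involutive; not-¬)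
open import Data.Product using (∃; _×_; _,_; map₂)
open import Data.Sum using (_⊎_; inj₁; inj₂)
open import Function using (_∘_)
open import Function.Bundles using (Inverse; Injection)
open import Function.Properties.Inverse using (Inverse⇒Injection)
open import Relation.Nullary using (¬_; Dec; yes; no; contradiction)
open import Relation.Nullary.Decidable using (via-injection)
open import Relation.Binary.PropositionalEquality as ≡ using (_≡_; _≢_; refl; cong)
open import Algebra.Bundles using (Group)
import Algebra.Construct.DirectProduct as DP
import Algebra.Properties.Group as GroupProperties
import Relation.Binary.Reasoning.Setoid as SetoidReasoning

even⊎odd : ∀ n → ∃ λ m → n ≡ m + m ⊎ n ≡ suc (m + m)
even⊎odd zero = 0 , inj₁ refl
even⊎odd (suc n) with even⊎odd n
... | m , inj₁ n≡m+m = m , inj₂ (cong suc n≡m+m)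
... | m , inj₂ n≡1+m+m = suc m , inj₁ (≡.trans (cong suc n≡1+m+m) (≡.sym (cong suc (+-suc m m))))

module RemovePair {m : ℕ} (f : Fin (suc (suc m)) → Fin (suc (suc m)))
    (f-involutive : ∀ i → f (f i) ≡ i) (f-fixedPointFree : ∀ i → f i ≢ i)
    {b : Fin (suc m)} (f0≡sb : f zero ≡ suc b) where

  open ≡.≡-Reasoning

  embed : Fin m → Fin (suc (suc m))
  embed i = suc (punchIn b i)

  unembed : (x : Fin (suc (suc m))) → x ≢ zero → x ≢ suc b → Fin m
  unembed zero    x≢0 _    = contradiction refl x≢0
  unembed (suc c) _   c≢b = punchOut (c≢b ∘ cong suc ∘ ≡.sym)

  embed-unembed : ∀ x x≢0 x≢sb → embed (unembed x x≢0 x≢sb) ≡ x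
  embed-unembed zero    x≢0 _ = contradiction refl x≢0
  embed-unembed (suc c) _   _ = cong suc (punchIn-punchOut _)

  unembed-unique : ∀ x x≢0 x≢sb i → x ≡ embed i → unembed x x≢0 x≢sb ≡ i
  unembed-unique _ _ _ i refl = ≡.trans (punchOut-cong b refl) (punchOut-punchIn b)

  f∘embed≢0 : ∀ i → f (embed i) ≢ zero
  f∘embed≢0 i eq = punchInᵢ≢i b i (suc-injective (begin
    embed i         ≡⟨ f-involutive (embed i) ⟨
    f (f (embed i)) ≡⟨ cong f eq ⟩
    f zero          ≡⟨ f0≡sb ⟩
    suc b           ∎))

  f∘embed≢sb : ∀ i → f (embed i) ≢ suc b
  f∘embed≢sb i eq = 0≢1+n (begin
    zero            ≡⟨ f-involutive zero ⟨
    f (f zero)      ≡⟨ cong f f0≡sb ⟩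
    f (suc b)       ≡⟨ cong f eq ⟨
    f (f (embed i)) ≡⟨ f-involutive (embed i) ⟩
    embed i         ∎)

  restrict : Fin m → Fin m
  restrict i = unembed (f (embed i)) (f∘embed≢0 i) (f∘embed≢sb i)

  embed-restrict : ∀ i → embed (restrict i) ≡ f (embed i)
  embed-restrict i = embed-unembed _ _ _

  restrict-involutive : ∀ i → restrict (restrict i) ≡ i
  restrict-involutive i =
    unembed-unique _ _ _ i (≡.trans (cong f (embed-restrict i)) (f-involutive (embed i)))

  restrict-fixedPointFree : ∀ i → restrict i ≢ i
  restrict-fixedPointFree i eq =
    f-fixedPointFree (embed i) (≡.trans (≡.sym (embed-restrict i)) (cong embed eq))

fixedPointFree-involution⇒even : ∀ n (f : Fin n → Fin n) →
  (∀ i → f (f i) ≡ i) → (∀ i → f i ≢ i) → 2 ∣ n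
fixedPointFree-involution⇒even zero _ _ _ = divides 0 refl
fixedPointFree-involution⇒even (suc zero) f _ f-fixedPointFree with f zero in f0≡
... | zero = contradiction f0≡ (f-fixedPointFree zero)
fixedPointFree-involution⇒even (suc (suc m)) f f-involutive f-fixedPointFree with f zero in f0≡
... | zero = contradiction f0≡ (f-fixedPointFree zero)
... | suc _ with fixedPointFree-involution⇒even m restrict restrict-involutive restrict-fixedPointFree
  where open RemovePair f f-involutive f-fixedPointFree f0≡
...   | divides q m≡q*2 = divides (suc q) (cong (λ k → suc (suc k)) m≡q*2)

module _ {c ℓ} (G : Group c ℓ) where
  open Group G
  open SetoidReasoning setoid

  pow-+ : ∀ x a b → pow G x (a + b) ≈ pow G x a ∙ pow G x b
  pow-+ x zero    b = sym (identityˡ _)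
  pow-+ x (suc a) b = trans (∙-congˡ (pow-+ x a b)) (sym (assoc _ _ _))

  involutionFree⇒odd-exponent : (∀ h → h ∙ h ≈ ε → h ≈ ε) →
    ∀ x k → pow G x (suc k) ≈ ε → ∃ λ m → pow G x (suc (m + m)) ≈ ε
  involutionFree⇒odd-exponent involutionFree x = <-rec _ halve
    where
    halve : ∀ k → (∀ {j} → j < k → pow G x (suc j) ≈ ε → ∃ λ m → pow G x (suc (m + m)) ≈ ε) →
      pow G x (suc k) ≈ ε → ∃ λ m → pow G x (suc (m + m)) ≈ ε
    halve k rec x^1+k≈ε with even⊎odd (suc k)
    ... | m , inj₂ 1+k≡1+m+m = m , trans (reflexive (cong (pow G x) (≡.sym 1+k≡1+m+m))) x^1+k≈ε
    ... | zero , inj₁ ()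
    ... | suc j , inj₁ 1+k≡1+j+1+j = rec j<k (involutionFree (pow G x (suc j)) (begin
      pow G x (suc j) ∙ pow G x (suc j) ≈⟨ pow-+ x (suc j) (suc j) ⟨
      pow G x (suc j + suc j)           ≡⟨ cong (pow G x) 1+k≡1+j+1+j ⟨
      pow G x (suc k)                   ≈⟨ x^1+k≈ε ⟩
      ε                                 ∎))
      where
      j<k : j < k
      j<k = ≤-<-trans (m≤m+n j j) (ℕ.≤-reflexive (≡.sym (≡.trans (ℕ.suc-injective 1+k≡1+j+1+j) (+-suc j j))))

  module _ {n : ℕ} (G-order : HasOrder G n) where
    open Inverse G-order using (to; from; to-cong; strictlyInverseˡ; strictlyInverseʳ)
    open GroupProperties G using (identityʳ-unique)

    to-injective : ∀ {x y} → to x ≡ to y → x ≈ y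
    to-injective = Injection.injective (Inverse⇒Injection G-order)

    _≟_ : ∀ x y → Dec (x ≈ y)
    _≟_ = via-injection (Inverse⇒Injection G-order) Fin._≟_

    pow-suc≈ε : ∀ x → ∃ λ k → pow G x (suc k) ≈ ε
    pow-suc≈ε x with pigeonhole (n<1+n n) (λ i → to (pow G x (toℕ i)))
    ... | i , j , i<j , x^i≡x^j = toℕ j ∸ suc (toℕ i) , identityʳ-unique (pow G x a) _ (begin
      pow G x a ∙ pow G x (suc d) ≈⟨ pow-+ x a (suc d) ⟨
      pow G x (a + suc d)         ≡⟨ cong (pow G x) (≡.trans (+-suc a d) (m+[n∸m]≡n i<j)) ⟩
      pow G x (toℕ j)             ≈⟨ to-injective x^i≡x^j ⟨
      pow G x a                   ∎)
      where
      a = toℕ i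
      d = toℕ j ∸ suc a

    odd-order⇒involutionFree : ¬ (2 ∣ n) → ∀ h → h ∙ h ≈ ε → h ≈ ε
    odd-order⇒involutionFree n-odd h h∙h≈ε with h ≟ ε
    ... | yes h≈ε = h≈ε
    ... | no h≉ε = contradiction
      (fixedPointFree-involution⇒even n ·h ·h-involutive ·h-fixedPointFree) n-odd
      where
      ·h : Fin n → Fin n
      ·h i = to (from i ∙ h)

      ·h-involutive : ∀ i → ·h (·h i) ≡ i
      ·h-involutive i = ≡.trans (to-cong (begin
        from (to (from i ∙ h)) ∙ h ≈⟨ ∙-congʳ (strictlyInverseʳ _) ⟩
        (from i ∙ h) ∙ h           ≈⟨ assoc _ _ _ ⟩
        from i ∙ (h ∙ h)           ≈⟨ ∙-congˡ h∙h≈ε ⟩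
        from i ∙ ε                 ≈⟨ identityʳ _ ⟩
        from i                     ∎)) (strictlyInverseˡ i)

      ·h-fixedPointFree : ∀ i → ·h i ≢ i
      ·h-fixedPointFree i ·hi≡i =
        h≉ε (identityʳ-unique (from i) h (to-injective (≡.trans ·hi≡i (≡.sym (strictlyInverseˡ i)))))

    odd-order⇒even-self-power : ¬ (2 ∣ n) → ∀ x → ∃ λ k → x ≈ pow G x (k + k)
    odd-order⇒even-self-power n-odd x with pow-suc≈ε x
    ... | k , x^1+k≈ε with involutionFree⇒odd-exponent (odd-order⇒involutionFree n-odd) x k x^1+k≈ε
    ... | m , x^1+m+m≈ε = suc m , (begin
      x                           ≈⟨ identityʳ x ⟨
      x ∙ ε                       ≈⟨ ∙-congˡ x^1+m+m≈ε ⟨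
      pow G x (suc (suc (m + m))) ≡⟨ cong (pow G x ∘ suc) (+-suc m m) ⟨
      pow G x (suc m + suc m)     ∎)

pow-× : ∀ {a b ℓ₁ ℓ₂} (G : Group a ℓ₁) (H : Group b ℓ₂) g h k →
  pow (DP.group G H) (g , h) k ≡ (pow G g k , pow H h k)
pow-× G H g h zero    = refl
pow-× G H g h (suc k) rewrite pow-× G H g h k = refl

pow-C₂-even : ∀ b k → pow C₂ b (k + k) ≡ false
pow-C₂-even b k = ≡.trans (pow-+ C₂ b k k) (xor-same (pow C₂ b k))

module _ (G : Group 0ℓ 0ℓ) (even-self-power : ∀ x → ∃ λ k → Group._≈_ G x (pow G x (k + k))) where
  open Group G using (_≈_; sym; trans) renaming (refl to ≈-refl)
  module G×C₂ = Group (G ×C₂)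

  Flip : G×C₂.Carrier → G×C₂.Carrier → Set
  Flip (g , a) (h , b) = g ≈ h × b ≡ not a

  false-isPower-true : ∀ g → ∃ λ k → (g , false) G×C₂.≈ pow (G ×C₂) (g , true) k
  false-isPower-true g with even-self-power g
  ... | k , g≈g^2k = k + k ,
    G×C₂.trans (g≈g^2k , ≡.sym (pow-C₂-even true k)) (G×C₂.reflexive (≡.sym (pow-× G C₂ g true (k + k))))

  Flip⇒PowerAdj : ∀ {x y} → Flip x y → PowerAdj (G ×C₂) x y
  Flip⇒PowerAdj {g , a} {h , _} (g≈h , ≡.refl) = (λ (_ , a≡¬a) → not-¬ ≡.refl a≡¬a) , isPower a
    where
    isPower : ∀ a → (∃ λ k → (g , a) G×C₂.≈ pow (G ×C₂) (h , not a) k)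
                  ⊎ (∃ λ k → (h , not a) G×C₂.≈ pow (G ×C₂) (g , a) k)
    isPower false = inj₁ (map₂ (G×C₂.trans (g≈h , ≡.refl)) (false-isPower-true h))
    isPower true  = inj₂ (map₂ (G×C₂.trans (sym g≈h , ≡.refl)) (false-isPower-true g))

  perfectMatching-×C₂ : PerfectMatching (G ×C₂)
  perfectMatching-×C₂ = record
    { M        = Flip
    ; M-resp   = λ { (g≈g′ , ≡.refl) (h≈h′ , ≡.refl) (g≈h , b≡¬a) → trans (sym g≈g′) (trans g≈h h≈h′) , b≡¬a }
    ; M-sym    = λ { {_ , a} (g≈h , ≡.refl) → sym g≈h , ≡.sym (not-involutive a) }
    ; M-edge   = Flip⇒PowerAdj
    ; M-cover  = λ { (g , a) → (g , not a) , ≈-refl , ≡.refl }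
    ; M-unique = λ { (g≈h , b≡¬a) (g≈k , c≡¬a) → trans (sym g≈h) g≈k , ≡.trans b≡¬a (≡.sym c≡¬a) }
    }

mainTheorem12 : (G : Group 0ℓ 0ℓ) (n : ℕ) → HasOrder G n → ¬ (2 ∣ n) →
    PerfectMatching (G ×C₂)
mainTheorem12 G n G-order n-odd =
  perfectMatching-×C₂ G (odd-order⇒even-self-power G G-order n-odd)
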